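{- Let $G$ be a bridgeless graph with diameter $2$. If $G$ has a cut vertex, then $rc(G)\leq 3$.
   Context: All graphs are finite, simple and undirected; a graph is bridgeless if no edge's removal disconnects it. In an edge-colored graph (adjacent edges may receive the same color), a path is a rainbow path if no two of its edges have the same color. The rainbow connection number $rc(G)$ of a connected graph $G$ is the minimum integer $i$ such that there is an edge-coloring of $G$ with $i$ colors in which every two distinct vertices of $G$ are connected by a rainbow path. -}

module Defs where

open import Data.Nat using (ℕ)
open import Data.Fin using (Fin)
open import Data.Bool using (Bool; T)
open import Data.List using (List; []; _∷_)
open import Data.List.Relation.Unary.All using (All)
open import Data.List.Relation.Unary.Unique.Propositional using (Unique)
open import Data.Product using (Σ; ∃; ∃-syntax; _×_; _,_)
open import Data.Sum using (_⊎_)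
open import Relation.Nullary using (¬_)
open import Relation.Binary.PropositionalEquality using (_≡_; _≢_)

record Graph : Set where
  field
    n     : ℕ
    adj   : Fin n → Fin n → Bool
    sym   : ∀ u v → adj u v ≡ adj v u
    irrefl : ∀ u → adj u u ≡ Data.Bool.false
open Graph public

V : Graph → Set
V G = Fin (n G)

Adj : (G : Graph) → V G → V G → Set
Adj G u v = T (adj G u v)

data Walk {A : Set} (E : A → A → Set) : A → A → Set where
  [] : ∀ {u} → Walk E u u
  _∷_ : ∀ {u w v} → E u w → Walk E w v → Walk E u v

verts : ∀ {A} {E : A → A → Set} {u v} → Walk E u v → List A
verts {u = u} [] = u ∷ []
verts {u = u} (e ∷ p) = u ∷ verts p

IsPath : ∀ {A} {E : A → A → Set} {u v} → Walk E u v → Set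
IsPath p = Unique (verts p)

PathBetween : ∀ {A} → (A → A → Set) → A → A → Set
PathBetween E u v = Σ (Walk E u v) IsPath

Connected : Graph → Set
Connected G = ∀ (u v : V G) → PathBetween (Adj G) u v

AdjMinusEdge : (G : Graph) → V G → V G → V G → V G → Set
AdjMinusEdge G x y a b = Adj G a b × ¬ ((a ≡ x × b ≡ y) ⊎ (a ≡ y × b ≡ x))

IsBridge : (G : Graph) → V G → V G → Set
IsBridge G x y = Adj G x y ×
  ∃[ u ] ∃[ v ] ¬ PathBetween (AdjMinusEdge G x y) u v

Bridgeless : Graph → Set
Bridgeless G = ∀ x y → ¬ IsBridge G x y

PathAvoiding : (G : Graph) → V G → V G → V G → Set
PathAvoiding G x u v = Σ (Walk (Adj G) u v) λ p → IsPath p × All (_≢ x) (verts p)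

IsCutVertex : (G : Graph) → V G → Set
IsCutVertex G x = ∃[ u ] ∃[ v ] (u ≢ x × v ≢ x × ¬ PathAvoiding G x u v)

HasCutVertex : Graph → Set
HasCutVertex G = ∃[ x ] IsCutVertex G x

DistLe2 : (G : Graph) → V G → V G → Set
DistLe2 G u v = u ≡ v ⊎ Adj G u v ⊎ ∃[ w ] (Adj G u w × Adj G w v)

Dist2 : (G : Graph) → V G → V G → Set
Dist2 G u v = u ≢ v × ¬ Adj G u v × ∃[ w ] (Adj G u w × Adj G w v)

Diameter2 : Graph → Set
Diameter2 G = Connected G × (∀ u v → DistLe2 G u v) × ∃[ u ] ∃[ v ] Dist2 G u v

record EdgeColouring (G : Graph) (k : ℕ) : Set where
  field
    col    : V G → V G → Fin k
    col-sym : ∀ u v → Adj G u v → col u v ≡ col v u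
open EdgeColouring public

colours : ∀ {G : Graph} {k} (c : EdgeColouring G k) {u v} →
          Walk (Adj G) u v → List (Fin k)
colours c [] = []
colours c (_∷_ {u} {w} e p) = col c u w ∷ colours c p

RainbowPath : ∀ {G : Graph} {k} → EdgeColouring G k → V G → V G → Set
RainbowPath {G} c u v =
  Σ (Walk (Adj G) u v) λ p → IsPath p × Unique (colours c p)

RainbowConnected : ∀ {G : Graph} {k} → EdgeColouring G k → Set
RainbowConnected {G} c = ∀ (u v : V G) → u ≢ v → RainbowPath c u v

rc≤ : Graph → ℕ → Set
rc≤ G k = Σ (EdgeColouring G k) RainbowConnected

module Submission where

-- 1. Because every two vertices are at distance ≤ 2, a vertex u not adjacent
--    to x could be joined to every other vertex of G − x by walks of length
--    ≤ 2 avoiding x, so G − x would be connected; hence x is adjacent to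
--    every other vertex (cutVertex-dominates).
-- 2. Since the edge xu is not a bridge, every u ≠ x has a neighbour other
--    than x (bridgeless-noPendantEdge), i.e. G − x has no isolated vertex.
-- 3. A maximal independent set S of G − x, built greedily, splits G − x into
--    two sides such that every vertex has a neighbour on the other side
--    (twoSidedLabelling).
-- 4. Colour each edge xu by the side of u (colours 0, 1) and every edge of
--    G − x by colour 2.  Vertices on different sides are joined by the
--    rainbow path u x v; vertices on the same side by u a x v, where a is a
--    neighbour of u on the other side (StarColouring.rainbowConnected).

open import Defs
open import Data.Nat using (ℕ)
open import Data.Fin using (Fin; #_; _≟_)
open import Data.Fin.Properties using (any?)
open import Data.Bool using (Bool; true; false; T)
import Data.Bool.Properties as Bool
open import Data.List using (List; []; _∷_; allFin)
open import Data.List.Relation.Unary.All using (All; []; _∷_)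
open import Data.List.Relation.Unary.AllPairs using ([]; _∷_)
open import Data.List.Relation.Unary.Any using (here; there)
import Data.List.Relation.Unary.Any as Any
open import Data.List.Relation.Unary.All.Properties.Core using (¬Any⇒All¬)
open import Data.List.Membership.Propositional using (_∈_; _∉_; find; lose)
open import Data.List.Membership.Propositional.Properties using (∈-allFin)
import Data.List.Membership.DecPropositional as DecMembership
open import Data.Product using (∃-syntax; _×_; _,_; proj₁; proj₂)
open import Data.Sum using (_⊎_; inj₁; inj₂)
import Data.Sum as Sum
import Data.Product as Product
open import Data.Empty using (⊥; ⊥-elim)
open import Function using (_∘_)
open import Relation.Nullary using (¬_; Dec; yes; no; does; contradiction)
open import Relation.Nullary.Decidable using (_×-dec_; ¬?; dec-true; dec-false)
open import Relation.Nullary.Decidable.Core using (T?)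
open import Relation.Unary using (Decidable)
open import Relation.Binary.Definitions using (DecidableEquality)
open import Relation.Binary.PropositionalEquality
  using (_≡_; _≢_; refl; trans; subst; ≢-sym) renaming (sym to ≡-sym)

-- Walks.  A walk all of whose vertices satisfy P can be shortened to a path
-- all of whose vertices satisfy P; this is how walks in G − x are turned
-- into the paths required by IsCutVertex.
module _ {A : Set} {E : A → A → Set} where

  _++ʷ_ : ∀ {u w v} → Walk E u w → Walk E w v → Walk E u v
  []      ++ʷ q = q
  (e ∷ p) ++ʷ q = e ∷ (p ++ʷ q)

  all-++ʷ : ∀ {P : A → Set} {u w v} (p : Walk E u w) (q : Walk E w v) →
            All P (verts p) → All P (verts q) → All P (verts (p ++ʷ q))
  all-++ʷ []      q _          allQ = allQ
  all-++ʷ (e ∷ p) q (pu ∷ allP) allQ = pu ∷ all-++ʷ p q allP allQ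

  suffix : ∀ {P : A → Set} {w v} z (p : Walk E w v) → z ∈ verts p →
           IsPath p → All P (verts p) →
           ∃[ q ] (IsPath {E = E} {z} {v} q × All P (verts q))
  suffix z []      (here refl) path allP = [] , path , allP
  suffix z (e ∷ p) (here refl) path allP = e ∷ p , path , allP
  suffix z (e ∷ p) (there z∈p) (_ ∷ path) (_ ∷ allP) = suffix z p z∈p path allP

  -- recursively make the tail a path; if the start u reappears on it,
  -- cut out the closed detour by keeping only the suffix from u
  walk⇒path : DecidableEquality A → ∀ {P : A → Set} {u v} (p : Walk E u v) →
              All P (verts p) → ∃[ q ] (IsPath {E = E} {u} {v} q × All P (verts q))
  walk⇒path _≟ᴬ_ []      allP = [] , [] ∷ [] , allP
  walk⇒path _≟ᴬ_ {u = u} (e ∷ p) (pu ∷ allP)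
    with walk⇒path _≟ᴬ_ p allP
  ... | q , path , allQ with DecMembership._∈?_ _≟ᴬ_ u (verts q)
  ...   | yes u∈q = suffix u q u∈q path allQ
  ...   | no  u∉q = e ∷ q , ¬Any⇒All¬ (verts q) u∉q ∷ path , pu ∷ allQ

module GraphFacts (G : Graph) where

  adj-sym : ∀ {a b} → Adj G a b → Adj G b a
  adj-sym {a} {b} = subst T (Graph.sym G a b)

  adj⇒≢ : ∀ {a b} → Adj G a b → a ≢ b
  adj⇒≢ {a} e refl with subst T (irrefl G a) e
  ... | ()

shortWalkAvoiding : (G : Graph) {x a b : V G} → a ≢ x → b ≢ x →
                    ¬ (Adj G a x × Adj G x b) → DistLe2 G a b →
                    ∃[ p ] All (_≢ x) (verts {E = Adj G} {a} {b} p)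
shortWalkAvoiding G a≢x b≢x notCommon (inj₁ refl) = [] , a≢x ∷ []
shortWalkAvoiding G a≢x b≢x notCommon (inj₂ (inj₁ e)) = e ∷ [] , a≢x ∷ b≢x ∷ []
shortWalkAvoiding G a≢x b≢x notCommon (inj₂ (inj₂ (w , e₁ , e₂))) =
  e₁ ∷ e₂ ∷ [] , a≢x ∷ w≢x ∷ b≢x ∷ []
  where
    w≢x : w ≢ _
    w≢x refl = notCommon (e₁ , e₂)

-- Step 1: in a graph with all distances ≤ 2, a cut vertex is adjacent to
-- every other vertex; otherwise every component of G − x is joined to a
-- non-neighbour u of x by walks avoiding x.
cutVertex-dominates : (G : Graph) → (∀ u v → DistLe2 G u v) →
                      ∀ {x} → IsCutVertex G x → ∀ u → u ≢ x → Adj G x u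
cutVertex-dominates G dist {x} (u₀ , v₀ , u₀≢x , v₀≢x , disconnected) u u≢x
  with T? (adj G x u)
... | yes xu = xu
... | no ¬xu = ⊥-elim (disconnected (walk⇒path _≟_ (p ++ʷ q) (all-++ʷ p q avoidP avoidQ)))
  where
    open GraphFacts G
    u₀→u = shortWalkAvoiding G u₀≢x u≢x (¬xu ∘ proj₂) (dist u₀ u)
    u→v₀ = shortWalkAvoiding G u≢x v₀≢x (¬xu ∘ adj-sym ∘ proj₁) (dist u v₀)
    p = proj₁ u₀→u
    q = proj₁ u→v₀
    avoidP = proj₂ u₀→u
    avoidQ = proj₂ u→v₀

-- Step 2: in a bridgeless graph no edge xu is the only edge at u: else every
-- walk from u in G − xu is stuck at u, so xu would be a bridge.
bridgeless-noPendantEdge : (G : Graph) → Bridgeless G →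
                           ∀ {x u} → Adj G x u → ∃[ w ] (Adj G u w × w ≢ x)
bridgeless-noPendantEdge G bridgeless {x} {u} xu
  with any? (λ w → T? (adj G u w) ×-dec ¬? (w ≟ x))
... | yes other = other
... | no noOther = ⊥-elim (bridgeless x u (xu , u , x , λ (p , _) → stuck p refl refl))
  where
    open GraphFacts G

    onlyX : ∀ w → Adj G u w → w ≡ x
    onlyX w e with w ≟ x
    ... | yes w≡x = w≡x
    ... | no  w≢x = ⊥-elim (noOther (w , e , w≢x))

    stuck : ∀ {a b} → Walk (AdjMinusEdge G x u) a b → a ≡ u → b ≡ x → ⊥
    stuck [] refl u≡x = adj⇒≢ xu (≡-sym u≡x)
    stuck (_∷_ {w = w} (e , notXU) p) refl _ = notXU (inj₂ (refl , onlyX w e))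

module MaximalIndependentSet (G : Graph) {P : V G → Set} (P? : Decidable P) where
  open GraphFacts G

  record MaximalIn (vs : List (V G)) : Set where
    field
      set         : List (V G)
      ⊆P          : ∀ {a} → a ∈ set → P a
      independent : ∀ {a b} → a ∈ set → b ∈ set → ¬ Adj G a b
      dominates   : ∀ {u} → u ∈ vs → P u → u ∈ set ⊎ ∃[ a ] (a ∈ set × Adj G u a)
  open MaximalIn

  keep : ∀ {v vs} (M : MaximalIn vs) →
         (P v → v ∈ set M ⊎ ∃[ a ] (a ∈ set M × Adj G v a)) → MaximalIn (v ∷ vs)
  keep M dominatedV = record
    { set = set M ; ⊆P = ⊆P M ; independent = independent M
    ; dominates = λ { (here refl) → dominatedV ; (there u∈vs) → dominates M u∈vs } }

  add : ∀ {v vs} (M : MaximalIn vs) → P v → ¬ Any.Any (Adj G v) (set M) → MaximalIn (v ∷ vs)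
  add {v} M pv noNeighbour = record
    { set = v ∷ set M
    ; ⊆P = λ { (here refl) → pv ; (there a∈S) → ⊆P M a∈S }
    ; independent = independent′
    ; dominates = λ { (here refl) _ → inj₁ (here refl)
                    ; (there u∈vs) pu → Sum.map there (Product.map₂ (Product.map₁ there))
                                                   (dominates M u∈vs pu) } }
    where
      independent′ : ∀ {a b} → a ∈ v ∷ set M → b ∈ v ∷ set M → ¬ Adj G a b
      independent′ (here refl)  (here refl)  e = adj⇒≢ e refl
      independent′ (here refl)  (there b∈S) e = noNeighbour (lose b∈S e)
      independent′ (there a∈S) (here refl)  e = noNeighbour (lose a∈S (adj-sym e))
      independent′ (there a∈S) (there b∈S) = independent M a∈S b∈S

  greedy : ∀ vs → MaximalIn vs
  greedy [] = record { set = [] ; ⊆P = λ () ; independent = λ () ; dominates = λ () }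
  greedy (v ∷ vs) = extend (greedy vs)
    where
      extend : MaximalIn vs → MaximalIn (v ∷ vs)
      extend M with P? v | Any.any? (λ a → T? (adj G v a)) (set M)
      ... | no ¬pv | _         = keep M (λ pv → contradiction pv ¬pv)
      ... | yes _  | yes nbr   = keep M (λ _ → inj₂ (find nbr))
      ... | yes pv | no ¬nbr   = add M pv ¬nbr

-- Step 3b: if every P-vertex has a neighbour in P, the P-vertices can be
-- labelled so that each has a neighbour in P with the other label: label by
-- membership in a maximal independent set.
twoSidedLabelling : (G : Graph) {P : V G → Set} → Decidable P →
                    (∀ u → P u → ∃[ w ] (Adj G u w × P w)) →
                    ∃[ side ] (∀ u → P u → ∃[ a ] (Adj G u a × P a × side a ≢ side u))
twoSidedLabelling G {P} P? neighbourInP = side , otherSide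
  where
    open MaximalIndependentSet G P?
    M = greedy (allFin (n G))
    S = MaximalIn.set M
    open DecMembership (_≟_ {n G}) using (_∈?_)

    side : V G → Bool
    side u = does (u ∈? S)

    sidesDiffer : ∀ {a u} → a ∈ S → u ∉ S → side a ≢ side u
    sidesDiffer {a} {u} a∈S u∉S eq
      with trans (≡-sym (dec-true (a ∈? S) a∈S)) (trans eq (dec-false (u ∈? S) u∉S))
    ... | ()

    otherSide : ∀ u → P u → ∃[ a ] (Adj G u a × P a × side a ≢ side u)
    otherSide u pu = byMembership (u ∈? S)
      where
        byMembership : Dec (u ∈ S) → ∃[ a ] (Adj G u a × P a × side a ≢ side u)
        byMembership (yes u∈S) =
          let w , e , pw = neighbourInP u pu
              w∉S = λ w∈S → MaximalIn.independent M u∈S w∈S e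
          in w , e , pw , ≢-sym (sidesDiffer u∈S w∉S)
        byMembership (no u∉S) with MaximalIn.dominates M (∈-allFin u) pu
        ... | inj₁ u∈S = contradiction u∈S u∉S
        ... | inj₂ (a , a∈S , e) = a , e , MaximalIn.⊆P M a∈S , sidesDiffer a∈S u∉S

module _ {G : Graph} {k : ℕ} (c : EdgeColouring G k) where
  open GraphFacts G

  rainbowPath₁ : ∀ {u v} → Adj G u v → RainbowPath c u v
  rainbowPath₁ e = e ∷ [] , (adj⇒≢ e ∷ []) ∷ [] ∷ [] , [] ∷ []

  rainbowPath₂ : ∀ {u w v} (e₁ : Adj G u w) (e₂ : Adj G w v) → u ≢ v →
                 col c u w ≢ col c w v → RainbowPath c u v
  rainbowPath₂ e₁ e₂ u≢v c₁≢c₂ =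
    e₁ ∷ e₂ ∷ [] ,
    (adj⇒≢ e₁ ∷ u≢v ∷ []) ∷ (adj⇒≢ e₂ ∷ []) ∷ [] ∷ [] ,
    (c₁≢c₂ ∷ []) ∷ [] ∷ []

  rainbowPath₃ : ∀ {u a b v} (e₁ : Adj G u a) (e₂ : Adj G a b) (e₃ : Adj G b v) →
                 u ≢ b → a ≢ v → u ≢ v →
                 col c u a ≢ col c a b → col c u a ≢ col c b v → col c a b ≢ col c b v →
                 RainbowPath c u v
  rainbowPath₃ e₁ e₂ e₃ u≢b a≢v u≢v c₁≢c₂ c₁≢c₃ c₂≢c₃ =
    e₁ ∷ e₂ ∷ e₃ ∷ [] ,
    (adj⇒≢ e₁ ∷ u≢b ∷ u≢v ∷ []) ∷ (adj⇒≢ e₂ ∷ a≢v ∷ []) ∷ (adj⇒≢ e₃ ∷ []) ∷ [] ∷ [] ,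
    (c₁≢c₂ ∷ c₁≢c₃ ∷ []) ∷ (c₂≢c₃ ∷ []) ∷ [] ∷ []

module StarColouring (G : Graph) (x : V G) (side : V G → Bool) where
  open GraphFacts G

  label : Bool → Fin 3
  label true  = # 0
  label false = # 1

  label-injective : ∀ {s t} → label s ≡ label t → s ≡ t
  label-injective {true}  {true}  _ = refl
  label-injective {false} {false} _ = refl

  label≢2 : ∀ s → label s ≢ # 2
  label≢2 true  ()
  label≢2 false ()

  colour : V G → V G → Fin 3
  colour a b with a ≟ x | b ≟ x
  ... | yes _ | _     = label (side b)
  ... | no _  | yes _ = label (side a)
  ... | no _  | no _  = # 2

  colour-from-x : ∀ b → colour x b ≡ label (side b)
  colour-from-x b with x ≟ x
  ... | yes _ = refl
  ... | no x≢x = contradiction refl x≢x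

  colour-to-x : ∀ a → a ≢ x → colour a x ≡ label (side a)
  colour-to-x a a≢x with a ≟ x | x ≟ x
  ... | yes a≡x | _      = contradiction a≡x a≢x
  ... | no _    | yes _  = refl
  ... | no _    | no x≢x = contradiction refl x≢x

  colour-away : ∀ a b → a ≢ x → b ≢ x → colour a b ≡ # 2
  colour-away a b a≢x b≢x with a ≟ x | b ≟ x
  ... | yes a≡x | _       = contradiction a≡x a≢x
  ... | no _    | yes b≡x = contradiction b≡x b≢x
  ... | no _    | no _    = refl

  colour-sym : ∀ a b → colour a b ≡ colour b a
  colour-sym a b = byCases (a ≟ x) (b ≟ x)
    where
      byCases : Dec (a ≡ x) → Dec (b ≡ x) → colour a b ≡ colour b a
      byCases (yes refl) (yes refl) = refl
      byCases (yes refl) (no b≢x)   = trans (colour-from-x b) (≡-sym (colour-to-x b b≢x))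
      byCases (no a≢x)   (yes refl) = trans (colour-to-x a a≢x) (≡-sym (colour-from-x a))
      byCases (no a≢x)   (no b≢x)   =
        trans (colour-away a b a≢x b≢x) (≡-sym (colour-away b a b≢x a≢x))

  starColouring : EdgeColouring G 3
  starColouring = record { col = colour ; col-sym = λ a b _ → colour-sym a b }

  spokesDiffer : ∀ {u v} → u ≢ x → side u ≢ side v → colour u x ≢ colour x v
  spokesDiffer {u} {v} u≢x differ eq =
    differ (label-injective (trans (≡-sym (colour-to-x u u≢x)) (trans eq (colour-from-x v))))

  rainbowConnected : (∀ u → u ≢ x → Adj G x u) →
                     (∀ u → u ≢ x → ∃[ a ] (Adj G u a × a ≢ x × side a ≢ side u)) →
                     RainbowConnected starColouring
  rainbowConnected spoke otherSide u v u≢v with u ≟ x | v ≟ x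
  ... | yes refl | _        = rainbowPath₁ starColouring (spoke v (≢-sym u≢v))
  ... | no u≢x   | yes refl = rainbowPath₁ starColouring (adj-sym (spoke u u≢x))
  ... | no u≢x   | no v≢x   with side u Bool.≟ side v
  ...   | no differ = rainbowPath₂ starColouring (adj-sym (spoke u u≢x)) (spoke v v≢x)
                        u≢v (spokesDiffer u≢x differ)
  ...   | yes same  =
    let a , ua , a≢x , differ = otherSide u u≢x
        a≢v = λ { refl → differ (≡-sym same) }
        away≢label = λ s eq → label≢2 s (≡-sym (trans (≡-sym (colour-away u a u≢x a≢x)) eq))
    in rainbowPath₃ starColouring ua (adj-sym (spoke a a≢x)) (spoke v v≢x) u≢x a≢v u≢v
         (away≢label (side a) ∘ (λ eq → trans eq (colour-to-x a a≢x)))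
         (away≢label (side v) ∘ (λ eq → trans eq (colour-from-x v)))
         (spokesDiffer a≢x (differ ∘ (λ eq → trans eq (≡-sym same))))

lemma1 : (G : Graph) → Bridgeless G → Diameter2 G → HasCutVertex G → rc≤ G 3
lemma1 G bridgeless (_ , dist , _) (x , cut) =
  starColouring , rainbowConnected spoke otherSide
  where
    spoke : ∀ u → u ≢ x → Adj G x u
    spoke = cutVertex-dominates G dist cut

    neighbourAwayFromX : ∀ u → u ≢ x → ∃[ w ] (Adj G u w × w ≢ x)
    neighbourAwayFromX u u≢x = bridgeless-noPendantEdge G bridgeless (spoke u u≢x)

    labelling = twoSidedLabelling G (λ u → ¬? (u ≟ x)) neighbourAwayFromX
    open StarColouring G x (proj₁ labelling)

    otherSide : ∀ u → u ≢ x → ∃[ a ] (Adj G u a × a ≢ x × proj₁ labelling a ≢ proj₁ labelling u)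
    otherSide = proj₂ labelling
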